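{- Let $W := \mathbb{Z}^2 \setminus \{(0,n) : n \in \mathbb{N}\} \subseteq \mathbb{Z}^2$. Any subset $S \subseteq \mathbb{Z}^2$ consisting of two points with distinct $x$-coordinates is a complement to $W$ and a minimal complement to $W$ in $\mathbb{Z}^2$. Any infinite subset $C \subseteq \{(0,n) : n \in \mathbb{N}\}$ is a complement to $W$ in $\mathbb{Z}^2$; consequently, $C$ is not a minimal complement to $W$.
   Context: For an abelian group $G$ and nonempty subsets $W, W' \subseteq G$, $W'$ is a complement of $W$ in $G$ if $W + W' = G$; it is a minimal complement if moreover $W + (W' \setminus \{w'\}) \neq G$ for every $w' \in W'$. $\mathbb{N}$ denotes the set of natural numbers. -}

module Defs where

open import Data.Nat using (ℕ)
open import Data.Integer using (ℤ; +_) renaming (_+_ to _+ℤ_)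
open import Data.Product using (Σ; _×_; _,_; proj₁; proj₂; ∃-syntax)
open import Data.Sum using (_⊎_)
open import Data.List using (List)
open import Data.List.Membership.Propositional using (_∉_)
open import Relation.Nullary using (¬_)
open import Relation.Binary.PropositionalEquality using (_≡_; _≢_)

ℤ² : Set
ℤ² = ℤ × ℤ

_+²_ : ℤ² → ℤ² → ℤ²
(a , b) +² (c , d) = (a +ℤ c) , (b +ℤ d)

Subset : Set₁
Subset = ℤ² → Set

_⊆_ : Subset → Subset → Set
A ⊆ B = ∀ p → A p → B p

_∖｛_｝ : Subset → ℤ² → Subset
(A ∖｛ x ｝) p = A p × p ≢ x

IsComplement : Subset → Subset → Set
IsComplement W W' = ∀ g → ∃[ w ] ∃[ w' ] (W w × W' w' × w +² w' ≡ g)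

IsMinimalComplement : Subset → Subset → Set
IsMinimalComplement W W' =
  IsComplement W W' × (∀ w' → W' w' → ¬ IsComplement W (W' ∖｛ w' ｝))

Ray : Subset
Ray p = ∃[ n ] (p ≡ (+ 0 , + n))

W₀ : Subset
W₀ p = ¬ Ray p

Pair : ℤ² → ℤ² → Subset
Pair a b p = (p ≡ a) ⊎ (p ≡ b)

-- Constructive notion of an infinite subset: it is not exhausted by any
-- finite list of points (classically equivalent to "not finite").
Infinite : Subset → Set
Infinite C = (xs : List ℤ²) → ∃[ p ] (C p × p ∉ xs)

-- Write S for a candidate complement.  Since w + s = g forces w = g - s,
-- S is a complement of W₀ as soon as every g ∈ ℤ² has a point s ∈ S whose
-- difference g - s avoids the ray; conversely W₀ + {s} never contains s,
-- because the origin lies on the ray.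
--
-- * For S = {a, b} with a₁ ≠ b₁ we take s ∈ {a, b} in a different column
--   from g; then g - s has non-zero first coordinate.  Removing one point
--   leaves at most the other one, which cannot cover itself.
-- * For an infinite C ⊆ Ray and g = (g₁, g₂) we take (0, n) ∈ C with
--   n > |g₂|; then g - (0, n) has negative second coordinate.  Removing a
--   point from an infinite set leaves an infinite set, so C ∖ {c} is still
--   a complement and C is not minimal.
module Submission where

open import Defs
open import Data.Product using (_×_; proj₁; proj₂; _,_; ∃-syntax)
open import Relation.Nullary using (¬_; yes; no; contradiction)
open import Relation.Binary.PropositionalEquality
  using (_≢_; _≡_; refl; sym; trans; cong; cong₂; subst; module ≡-Reasoning)
open import Data.Nat as ℕ using (ℕ)
import Data.Nat.Properties as ℕP
open import Data.Integer as ℤ using (+_; _-_; ∣_∣) renaming (_+_ to _+ℤ_)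
import Data.Integer.Properties as ℤP
open import Algebra.Bundles using (AbelianGroup)
open import Algebra.Properties.Group (AbelianGroup.group ℤP.+-0-abelianGroup)
  using (//-rightDividesˡ; identityˡ-unique)
open import Data.Sum using (inj₁; inj₂)
open import Data.List using (List; []; _∷_; applyUpTo)
open import Data.List.Membership.Propositional.Properties using (∈-applyUpTo⁺)
open import Data.List.Relation.Unary.Any using (here; there)

_-²_ : ℤ² → ℤ² → ℤ²
(a , b) -² (c , d) = (a - c) , (b - d)

-²-+²-cancel : ∀ g a → (g -² a) +² a ≡ g
-²-+²-cancel (g₁ , g₂) (a₁ , a₂) =
  cong₂ _,_ (//-rightDividesˡ a₁ g₁) (//-rightDividesˡ a₂ g₂)

+²-identityˡ-unique : ∀ w s → w +² s ≡ s → w ≡ (+ 0 , + 0)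
+²-identityˡ-unique (w₁ , w₂) (s₁ , s₂) e =
  cong₂ _,_ (identityˡ-unique w₁ s₁ (cong proj₁ e))
            (identityˡ-unique w₂ s₂ (cong proj₂ e))

complement-by-differences :
  (S : Subset) → (∀ g → ∃[ s ] (S s × W₀ (g -² s))) → IsComplement W₀ S
complement-by-differences S pick g =
  let (s , s∈S , g-s∈W₀) = pick g in g -² s , s , g-s∈W₀ , s∈S , -²-+²-cancel g s

-- A set with at most one point s is not a complement of W₀: s ∉ W₀ + {s}.
not-complement-⊆-singleton :
  (S : Subset) (s : ℤ²) → (∀ p → S p → p ≡ s) → ¬ IsComplement W₀ S
not-complement-⊆-singleton S s only-s complement
  with complement s
... | w , v , w∈W₀ , v∈S , w+v≡s rewrite only-s v v∈S =
  w∈W₀ (0 , +²-identityˡ-unique w s w+v≡s)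

-- Points of the ray lie in column 0, so differences of points in distinct
-- columns lie in W₀.
off-column-difference : ∀ g a → proj₁ g ≢ proj₁ a → W₀ (g -² a)
off-column-difference (g₁ , g₂) (a₁ , a₂) g₁≢a₁ (n , e) = g₁≢a₁ (begin
  g₁                 ≡⟨ sym (//-rightDividesˡ a₁ g₁) ⟩
  (g₁ - a₁) +ℤ a₁    ≡⟨ cong (_+ℤ a₁) (cong proj₁ e) ⟩
  + 0 +ℤ a₁          ≡⟨ ℤP.+-identityˡ a₁ ⟩
  a₁                 ∎)
  where open ≡-Reasoning

-- Two points in distinct columns: g lies outside the column of one of them.
pair-complement : (a b : ℤ²) → proj₁ a ≢ proj₁ b → IsComplement W₀ (Pair a b)
pair-complement a b a₁≢b₁ = complement-by-differences (Pair a b) pick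
  where
  pick : ∀ g → ∃[ s ] (Pair a b s × W₀ (g -² s))
  pick g with proj₁ g ℤ.≟ proj₁ a
  ... | no  g₁≢a₁ = a , inj₁ refl , off-column-difference g a g₁≢a₁
  ... | yes g₁≡a₁ = b , inj₂ refl ,
                    off-column-difference g b (λ g₁≡b₁ → a₁≢b₁ (trans (sym g₁≡a₁) g₁≡b₁))

pair-minimal : (a b : ℤ²) → ∀ s → Pair a b s → ¬ IsComplement W₀ (Pair a b ∖｛ s ｝)
pair-minimal a b s (inj₁ refl) = not-complement-⊆-singleton _ b only-b
  where
  only-b : ∀ p → (Pair a b ∖｛ a ｝) p → p ≡ b
  only-b p (inj₁ p≡a , p≢a) = contradiction p≡a p≢a
  only-b p (inj₂ p≡b , _)   = p≡b
pair-minimal a b s (inj₂ refl) = not-complement-⊆-singleton _ a only-a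
  where
  only-a : ∀ p → (Pair a b ∖｛ b ｝) p → p ≡ a
  only-a p (inj₁ p≡a , _)   = p≡a
  only-a p (inj₂ p≡b , p≢b) = contradiction p≡b p≢b

high-ray-difference : ∀ g n → ∣ proj₂ g ∣ ℕ.< n → W₀ (g -² (+ 0 , + n))
high-ray-difference (g₁ , g₂) n |g₂|<n (m , e) =
  ℕP.<⇒≱ |g₂|<n (subst (n ℕ.≤_) (cong ∣_∣ (sym g₂≡m+n)) (ℕP.m≤n+m n m))
  where
  open ≡-Reasoning
  g₂≡m+n : g₂ ≡ + (m ℕ.+ n)
  g₂≡m+n = begin
    g₂                 ≡⟨ sym (//-rightDividesˡ (+ n) g₂) ⟩
    (g₂ - + n) +ℤ + n  ≡⟨ cong (_+ℤ + n) (cong proj₂ e) ⟩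
    + m +ℤ + n         ≡⟨ ℤP.pos-+ m n ⟨
    + (m ℕ.+ n)        ∎

ray-upTo : ℕ → List ℤ²
ray-upTo k = applyUpTo (λ n → + 0 , + n) (ℕ.suc k)

infinite-ray-subset-unbounded :
  (C : Subset) → C ⊆ Ray → Infinite C → ∀ k → ∃[ n ] (C (+ 0 , + n) × k ℕ.< n)
infinite-ray-subset-unbounded C C⊆Ray inf k
  with inf (ray-upTo k)
... | p , p∈C , p∉segment with C⊆Ray p p∈C
... | n , refl =
  n , p∈C , ℕP.≰⇒> (λ n≤k → p∉segment (∈-applyUpTo⁺ (λ n → + 0 , + n) (ℕ.s≤s n≤k)))

infinite-ray-subset-complement :
  (C : Subset) → C ⊆ Ray → Infinite C → IsComplement W₀ C
infinite-ray-subset-complement C C⊆Ray inf = complement-by-differences C pick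
  where
  pick : ∀ g → ∃[ s ] (C s × W₀ (g -² s))
  pick g =
    let (n , n∈C , |g₂|<n) = infinite-ray-subset-unbounded C C⊆Ray inf ∣ proj₂ g ∣
    in (+ 0 , + n) , n∈C , high-ray-difference g n |g₂|<n

infinite-∖｛｝ : (C : Subset) (c : ℤ²) → Infinite C → Infinite (C ∖｛ c ｝)
infinite-∖｛｝ C c inf xs with inf (c ∷ xs)
... | p , p∈C , p∉c∷xs = p , (p∈C , λ p≡c → p∉c∷xs (here p≡c)) , λ p∈xs → p∉c∷xs (there p∈xs)

infinite-ray-subset-not-minimal :
  (C : Subset) → C ⊆ Ray → Infinite C → ¬ IsMinimalComplement W₀ C
infinite-ray-subset-not-minimal C C⊆Ray inf (_ , minimal) =
  let (c , c∈C , _) = inf [] in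
  minimal c c∈C (infinite-ray-subset-complement (C ∖｛ c ｝)
                   (λ p p∈C∖c → C⊆Ray p (proj₁ p∈C∖c)) (infinite-∖｛｝ C c inf))

lemma2p2 :
    ((a b : ℤ²) → proj₁ a ≢ proj₁ b →
      IsComplement W₀ (Pair a b) × IsMinimalComplement W₀ (Pair a b))
    ×
    ((C : Subset) → C ⊆ Ray → Infinite C →
      IsComplement W₀ C × ¬ IsMinimalComplement W₀ C)
lemma2p2 = two-points , infinite-ray-subsets
  where
  two-points : (a b : ℤ²) → proj₁ a ≢ proj₁ b →
    IsComplement W₀ (Pair a b) × IsMinimalComplement W₀ (Pair a b)
  two-points a b a₁≢b₁ =
    pair-complement a b a₁≢b₁ , pair-complement a b a₁≢b₁ , pair-minimal a b

  infinite-ray-subsets : (C : Subset) → C ⊆ Ray → Infinite C →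
    IsComplement W₀ C × ¬ IsMinimalComplement W₀ C
  infinite-ray-subsets C C⊆Ray inf =
    infinite-ray-subset-complement C C⊆Ray inf , infinite-ray-subset-not-minimal C C⊆Ray inf
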